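{- Let $\Gamma\cup\{\alpha\}\subseteq For_1$ be such that $\Gamma\vDash_{\mathbf{CPL}}\alpha$. If $var(\Gamma)\subseteq var(\alpha)$ or $\vDash_{\mathbf{CPL}}\alpha$, then $\Gamma\vDash_{\mathbf{H}_3}\alpha$.
   Context: Fix a denumerable set $prop$ of propositional variables. $For_1$ is the set of formulas built from $prop$ with unary $\lnot$ and binary $\vee$. $var(\alpha)$ is the set of propositional variables in $\alpha$; $var(\Gamma)=\bigcup_{\gamma\in\Gamma}var(\gamma)$. $\Gamma\vDash_{\mathbf{CPL}}\alpha$ means every classical (two-valued) valuation making all members of $\Gamma$ true makes $\alpha$ true; $\vDash_{\mathbf{CPL}}\alpha$ means $\alpha$ is a classical tautology. Halldén's logic $\mathbf{H}_3$ on $For_1$: truth values $\{1,\tfrac12,0\}$, designated set $\{1,\tfrac12\}$; valuations extend maps $prop\to\{1,\tfrac12,0\}$ by $\lnot1=0,\lnot\tfrac12=\tfrac12,\lnot0=1$, and $x\vee y=\tfrac12$ if $x=\tfrac12$ or $y=\tfrac12$, otherwise classical disjunction. $\Gamma\vDash_{\mathbf{H}_3}\alpha$ means every valuation assigning a designated value to every member of $\Gamma$ assigns a designated value to $\alpha$. -}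

module Defs where

open import Data.Nat using (ℕ)
open import Data.Bool using (Bool; true; false; not; _∨_; T)
open import Data.Sum using (_⊎_)
open import Relation.Binary.PropositionalEquality using (_≡_)

Prop : Set
Prop = ℕ

data Form : Set where
  var  : Prop → Form
  ¬'_  : Form → Form
  _∨'_ : Form → Form → Form

data _∈var_ (p : Prop) : Form → Set where
  here  : p ∈var var p
  inNeg : ∀ {a} → p ∈var a → p ∈var (¬' a)
  inL   : ∀ {a b} → p ∈var a → p ∈var (a ∨' b)
  inR   : ∀ {a b} → p ∈var b → p ∈var (a ∨' b)

-- sets of formulas as predicates (Γ may be infinite)
FormSet : Set₁
FormSet = Form → Set

varSub : FormSet → Form → Set
varSub Γ α = ∀ γ → Γ γ → ∀ p → p ∈var γ → p ∈var α

evalC : (Prop → Bool) → Form → Bool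
evalC v (var p)  = v p
evalC v (¬' a)   = not (evalC v a)
evalC v (a ∨' b) = evalC v a ∨ evalC v b

_⊨CPL_ : FormSet → Form → Set
Γ ⊨CPL α = ∀ (v : Prop → Bool) → (∀ γ → Γ γ → evalC v γ ≡ true) → evalC v α ≡ true

⊨CPL_ : Form → Set
⊨CPL α = ∀ (v : Prop → Bool) → evalC v α ≡ true

data V3 : Set where
  one half zero : V3

neg3 : V3 → V3
neg3 one  = zero
neg3 half = half
neg3 zero = one

or3 : V3 → V3 → V3
or3 half _    = half
or3 one  half = half
or3 zero half = half
or3 one  one  = one
or3 one  zero = one
or3 zero one  = one
or3 zero zero = zero

eval3 : (Prop → V3) → Form → V3
eval3 v (var p)  = v p
eval3 v (¬' a)   = neg3 (eval3 v a)
eval3 v (a ∨' b) = or3 (eval3 v a) (eval3 v b)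

Designated : V3 → Set
Designated x = (x ≡ one) ⊎ (x ≡ half)

_⊨H3_ : FormSet → Form → Set
Γ ⊨H3 α = ∀ (v : Prop → V3) → (∀ γ → Γ γ → Designated (eval3 v γ)) → Designated (eval3 v α)

module Submission where

-- In H₃ the value ½ is "infectious": a formula takes value ½ exactly
-- when one of its variables does (half-spreads, half-has-source).  Away from
-- ½ the connectives are classical, so every H₃ valuation v is shadowed by the
-- two-valued valuation ⌊v⌋ sending 1 to true and ½, 0 to false: each formula
-- either has value ½ under v or has value ⌊v⌋(φ) read back into {1, 0}
-- (collapse).  Given v designating Γ, if α has value ½ it is designated;
-- otherwise α is true under ⌊v⌋ — immediately if α is a tautology, and if
-- var(Γ) ⊆ var(α) because then no member of Γ has value ½ (no variable of α,
-- hence of Γ, is ½), so the collapse makes every member of Γ true under ⌊v⌋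
-- and Γ ⊨CPL α applies.

open import Defs
open import Data.Bool using (Bool; true; false; not; _∨_)
open import Data.Sum using (_⊎_; inj₁; inj₂)
open import Data.Product using (∃; _×_; _,_)
open import Data.Empty using (⊥-elim)
open import Relation.Nullary using (¬_)
open import Relation.Binary.PropositionalEquality using (_≡_; refl; sym; trans; cong)

embed : Bool → V3
embed true  = one
embed false = zero

shadow : V3 → Bool
shadow one  = true
shadow half = false
shadow zero = false

Collapses : V3 → Bool → Set
Collapses x b = (x ≡ half) ⊎ (x ≡ embed b)

collapses-to-shadow : ∀ x → Collapses x (shadow x)
collapses-to-shadow one  = inj₂ refl
collapses-to-shadow half = inj₁ refl
collapses-to-shadow zero = inj₂ refl

neg-collapses : ∀ {x b} → Collapses x b → Collapses (neg3 x) (not b)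
neg-collapses              (inj₁ refl) = inj₁ refl
neg-collapses {b = true}   (inj₂ refl) = inj₂ refl
neg-collapses {b = false}  (inj₂ refl) = inj₂ refl

or-collapses : ∀ {x y a b} → Collapses x a → Collapses y b → Collapses (or3 x y) (a ∨ b)
or-collapses               (inj₁ refl) _           = inj₁ refl
or-collapses {a = true}    (inj₂ refl) (inj₁ refl) = inj₁ refl
or-collapses {a = false}   (inj₂ refl) (inj₁ refl) = inj₁ refl
or-collapses {a = true}  {b = true}  (inj₂ refl) (inj₂ refl) = inj₂ refl
or-collapses {a = true}  {b = false} (inj₂ refl) (inj₂ refl) = inj₂ refl
or-collapses {a = false} {b = true}  (inj₂ refl) (inj₂ refl) = inj₂ refl
or-collapses {a = false} {b = false} (inj₂ refl) (inj₂ refl) = inj₂ refl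

-- ½ absorbs disjunction from the right (from the left it holds by definition).
or-halfʳ : ∀ x → or3 x half ≡ half
or-halfʳ one  = refl
or-halfʳ half = refl
or-halfʳ zero = refl

neg-half-inv : ∀ x → neg3 x ≡ half → x ≡ half
neg-half-inv half _ = refl
neg-half-inv one  ()
neg-half-inv zero ()

or-half-inv : ∀ x y → or3 x y ≡ half → (x ≡ half) ⊎ (y ≡ half)
or-half-inv half _    _  = inj₁ refl
or-half-inv one  half _  = inj₂ refl
or-half-inv zero half _  = inj₂ refl
or-half-inv one  one  ()
or-half-inv one  zero ()
or-half-inv zero one  ()
or-half-inv zero zero ()

embed≢half : ∀ b → ¬ (embed b ≡ half)
embed≢half true  ()
embed≢half false ()

designated-embed : ∀ b → Designated (embed b) → b ≡ true
designated-embed true  _        = refl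
designated-embed false (inj₁ ())
designated-embed false (inj₂ ())

module _ (v : Prop → V3) where

  ⌊v⌋ : Prop → Bool
  ⌊v⌋ p = shadow (v p)

  collapse : ∀ φ → Collapses (eval3 v φ) (evalC ⌊v⌋ φ)
  collapse (var p)  = collapses-to-shadow (v p)
  collapse (¬' a)   = neg-collapses (collapse a)
  collapse (a ∨' b) = or-collapses (collapse a) (collapse b)

  half-spreads : ∀ {p φ} → p ∈var φ → v p ≡ half → eval3 v φ ≡ half
  half-spreads here h = h
  half-spreads (inNeg m) h = cong neg3 (half-spreads m h)
  half-spreads (inL {b = b} m) h = cong (λ x → or3 x (eval3 v b)) (half-spreads m h)
  half-spreads (inR {a = a} m) h =
    trans (cong (or3 (eval3 v a)) (half-spreads m h)) (or-halfʳ (eval3 v a))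

  half-has-source : ∀ φ → eval3 v φ ≡ half → ∃ λ p → p ∈var φ × v p ≡ half
  half-has-source (var p) e = p , here , e
  half-has-source (¬' a) e with half-has-source a (neg-half-inv (eval3 v a) e)
  ... | p , m , h = p , inNeg m , h
  half-has-source (a ∨' b) e with or-half-inv (eval3 v a) (eval3 v b) e
  ... | inj₁ ea with half-has-source a ea
  ...   | p , m , h = p , inL m , h
  half-has-source (a ∨' b) e | inj₂ eb with half-has-source b eb
  ...   | p , m , h = p , inR m , h

  designated-classical : ∀ φ → Designated (eval3 v φ) → ¬ (eval3 v φ ≡ half) → evalC ⌊v⌋ φ ≡ true
  designated-classical φ d notHalf with collapse φ
  ... | inj₁ isHalf = ⊥-elim (notHalf isHalf)
  ... | inj₂ e rewrite e = designated-embed (evalC ⌊v⌋ φ) d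

mainTheorem7 : (Γ : FormSet) (α : Form) → Γ ⊨CPL α → (varSub Γ α ⊎ ⊨CPL α) → Γ ⊨H3 α
mainTheorem7 Γ α Γ⊨α side v desΓ with collapse v α
... | inj₁ αHalf = inj₂ αHalf
... | inj₂ αVal  = inj₁ (trans αVal (cong embed (α-true side)))
  where
  α-not-half : ¬ (eval3 v α ≡ half)
  α-not-half h = embed≢half (evalC (⌊v⌋ v) α) (trans (sym αVal) h)

  -- With var(Γ) ⊆ var(α), a ½ in some γ ∈ Γ would come from a variable of α.
  Γ-not-half : varSub Γ α → ∀ γ → Γ γ → ¬ (eval3 v γ ≡ half)
  Γ-not-half sub γ γ∈Γ h with half-has-source v γ h
  ... | p , p∈γ , vp = α-not-half (half-spreads v (sub γ γ∈Γ p p∈γ) vp)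

  α-true : varSub Γ α ⊎ ⊨CPL α → evalC (⌊v⌋ v) α ≡ true
  α-true (inj₁ sub)  = Γ⊨α (⌊v⌋ v) λ γ γ∈Γ →
    designated-classical v γ (desΓ γ γ∈Γ) (Γ-not-half sub γ γ∈Γ)
  α-true (inj₂ taut) = taut (⌊v⌋ v)
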